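{- Let $\Pi$ be a vertex subset problem and $\texttt{D}$ be a solution-preserving DP-core of table complexity $\alpha(k,n)$ solving $\Pi$. Let $G$ be an $n$-vertex graph and $\mathcal{T}=(T,B,\xi)$ a tree decomposition of $G$ of width $k$. Then there is a $T$-shaped tree automaton $\mathcal{A}$ over the alphabet $\{0,1\}$ of width at most $\alpha(k,n)$ whose language $\mathcal{L}(\mathcal{A})$ equals $\Phi_\Pi(G,\mathcal{T})=\{\chi[G,\mathcal{T},X]: X\in\mathrm{Sol}_\Pi(G)\}$.
   Context: Graphs, vertex subset problems, $\mathrm{Sol}_\Pi(G)$. A graph is $G=(V_G,E_G,\rho_G)$ with $V_G,E_G$ finite subsets of $\mathbb{N}$, $\rho_G\subseteq E_G\times V_G$ an incidence relation, $\mathrm{endpts}(e)=\{v:(e,v)\in\rho_G\}$. A vertex subset problem is a set $\Pi$ of pairs $(G,X)$ with $X\subseteq V_G$ finite, closed under graph isomorphism (an isomorphism $(\phi_1,\phi_2)$ sends $(G,X)$ to $(H,\phi_1(X))$). $\mathrm{Sol}_\Pi(G)=\{X:(G,X)\in\Pi\}$. Tree decompositions. An addressed tree is a rooted tree with the children of each node numbered. A (nice edge-introducing) tree decomposition of $G$ is $\mathcal{T}=(T,B,\xi)$, $T$ an addressed tree with nodes $N(T)$, $\xi:E_G\to N(T)$ injective, $B:N(T)\to\mathcal{P}(V_G)$, with: every vertex in some bag; $\mathrm{endpts}(e)\subseteq B(\xi(e))$; bags containing any fixed vertex form a connected subtree; every node has at most two children; leaves and root have empty bags; a node with two children $u',u''$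 has $B(u)=B(u')=B(u'')$ (join); a node $u$ with single child $u'$ introduces a vertex $v$ ($B(u)\setminus B(u')=\{v\}$), forgets a vertex $v$ ($B(u')\setminus B(u)=\{v\}$), or introduces an edge $e$ ($B(u)=B(u')$, $\xi(e)=u$). Width $=\max|B(u)|-1$. For $v\in V_G$, $\nu(v)$ is the child of the unique node at which $v$ is forgotten. DP-cores. A DP-core $\texttt{D}$ consists of a finite nonempty set $\mathrm{Leaf}\subseteq\{0,1\}^*$, functions $\mathrm{IntroVertex}:\mathbb{N}\times\{0,1\}^*\to\mathcal{P}_{fin}(\{0,1\}^*)$, $\mathrm{IntroEdge}:\mathbb{N}\times\mathbb{N}\times\{0,1\}^*\to\mathcal{P}_{fin}(\{0,1\}^*)$, $\mathrm{ForgetVertex}:\mathbb{N}\times\{0,1\}^*\to\mathcal{P}_{fin}(\{0,1\}^*)$, $\mathrm{Join}:\{0,1\}^*\times\{0,1\}^*\to\mathcal{P}_{fin}(\{0,1\}^*)$, and $\mathrm{Final}:\{0,1\}^*\to\{0,1\}$; these extend to sets of strings by union. It assigns to nodes sets $\Gamma(u)$: $\mathrm{Leaf}$ at leaves; $\mathrm{IntroVertex}(v,\Gamma(u'))$, $\mathrm{ForgetVertex}(v,\Gamma(u'))$, $\mathrm{IntroEdge}(v,v',\Gamma(u'))$ (with $\{v,v'\}=\mathrm{endpts}(e)$) at single-child nodes of the corresponding type; $\mathrm{Join}(\Gamma(u'),\Gamma(u''))$ at join nodes. It accepts $\mathcal{T}$ if some $w\in\Gamma(\text{root})$ has $\mathrm{Final}(w)=1$;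 it solves $\Pi$ if for all $G$ and all tree decompositions $\mathcal{T}$ of $G$ it accepts $\mathcal{T}$ iff $\mathrm{Sol}_\Pi(G)\ne\emptyset$; it has table complexity $\alpha(k,n)$ if $|\Gamma(u)|\le\alpha(k,n)$ for every node of every decomposition of width at most $k$ of every $n$-vertex graph. Solution-preserving. A witness tree for $\mathcal{T}$ is $W:N(T)\to\{0,1\}^*$ with $\mathrm{Final}(W(\text{root}))=1$, $W(u)\in\mathrm{Leaf}$ at leaves, $W(u)\in\mathrm{IntroVertex}(v,W(u'))$ / $\mathrm{ForgetVertex}(v,W(u'))$ / $\mathrm{IntroEdge}(v,v',W(u'))$ at single-child nodes of the corresponding type, and $W(u)\in\mathrm{Join}(W(u'),W(u''))$ at join nodes. An abstract membership function is $\mu:\mathbb{N}\times\{0,1\}^*\to\{0,1\}$; $\mathbf{X}(G,\mathcal{T},W,\mu)=\{v\in V_G:\mu(v,W(\nu(v)))=1\}$. $\texttt{D}$ is solution-preserving if there is such a $\mu$ with: for every $G$ and every tree decomposition $\mathcal{T}$ accepted by $\texttt{D}$, (1) $\mathbf{X}(G,\mathcal{T},W,\mu)\in\mathrm{Sol}_\Pi(G)$ for every witness tree $W$, and (2) every $X\in\mathrm{Sol}_\Pi(G)$ equals $\mathbf{X}(G,\mathcal{T},W,\mu)$ for some witness tree $W$. Tree automata. For a finite alphabet $\Sigma$ and addressed tree $T$, a $T$-shaped term is a map $\tau:N(T)\to\Sigma$. A $T$-shaped tree automaton is $\mathcal{A}=(\Sigma,Q,F,\Delta)$ with $Q$ partitioned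 into cells $\{Q_u\}_{u\in N(T)}$, $F\subseteq Q_{r}$ ($r$ the root), and $\Delta$ partitioned into $\{\Delta_u\}$ with $\Delta_u\subseteq Q_{u_1}\times\dots\times Q_{u_s}\times\Sigma\times Q_u$ where $u_1,\dots,u_s$ are the children of $u$ in order. A trace for $\tau$ is $\rho:N(T)\to Q$ with $(\rho(u_1),\dots,\rho(u_s),\tau(u),\rho(u))\in\Delta_u$ for all $u$; it is accepting if $\rho(r)\in F$; $\mathcal{L}(\mathcal{A})$ is the set of terms having an accepting trace. The width of $\mathcal{A}$ is $\max_u|Q_u|$. Characteristic trees. For $X\subseteq V_G$, $\chi[G,\mathcal{T},X]$ is the $T$-shaped term over $\{0,1\}$ with $\chi[G,\mathcal{T},X](u)=1$ if some $v\in X$ has $\nu(v)=u$, and $0$ otherwise. -}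

module Defs where

open import Data.Nat using (ℕ; zero; suc; _≤_)
open import Data.Bool using (Bool; true; false)
open import Data.Fin using (Fin; toℕ)
open import Data.List using (List; []; _∷_; _++_; [_]; length)
open import Data.List.Membership.Propositional using (_∈_; _∉_)
open import Data.List.Relation.Unary.Unique.Propositional using (Unique)
open import Data.Maybe using (Maybe; just; nothing)
open import Data.Product using (Σ; ∃; ∃-syntax; _×_; _,_)
open import Data.Sum using (_⊎_)
open import Function.Bundles using (_⇔_)
open import Relation.Binary.PropositionalEquality using (_≡_; _≢_)

-- Graphs  G = (V_G, E_G, ρ_G)
-- Finite subsets of ℕ are duplicate-free lists (set semantics).

record Graph : Set where
  field
    V    : List ℕ
    E    : List ℕ
    V-unique : Unique V
    E-unique : Unique E
    ρ    : List (ℕ × ℕ)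
    ρ-ok : ∀ e v → (e , v) ∈ ρ → (e ∈ E) × (v ∈ V)
    endpts-ok : ∀ e → e ∈ E → ∃[ v ] ∃[ v' ] (∀ x → (e , x) ∈ ρ ⇔ (x ≡ v ⊎ x ≡ v'))

open Graph public

-- {v , v'} = endpts(e), listed with v ≤ v' (canonical ordering for IntroEdge)
Endpts : Graph → ℕ → ℕ → ℕ → Set
Endpts G e v v' = (v ≤ v') × (∀ x → (e , x) ∈ ρ G ⇔ (x ≡ v ⊎ x ≡ v'))

_≈ˢ_ : List ℕ → List ℕ → Set
A ≈ˢ B = ∀ x → x ∈ A ⇔ x ∈ B

mapℕ : (ℕ → ℕ) → List ℕ → List ℕ
mapℕ f [] = []
mapℕ f (x ∷ xs) = f x ∷ mapℕ f xs

record Iso (G H : Graph) : Set where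
  field
    φ₁ : ℕ → ℕ
    φ₂ : ℕ → ℕ
    φ₁-into : ∀ v → v ∈ V G → φ₁ v ∈ V H
    φ₁-inj  : ∀ v w → v ∈ V G → w ∈ V G → φ₁ v ≡ φ₁ w → v ≡ w
    φ₁-onto : ∀ y → y ∈ V H → ∃[ v ] (v ∈ V G × φ₁ v ≡ y)
    φ₂-into : ∀ e → e ∈ E G → φ₂ e ∈ E H
    φ₂-inj  : ∀ e f → e ∈ E G → f ∈ E G → φ₂ e ≡ φ₂ f → e ≡ f
    φ₂-onto : ∀ y → y ∈ E H → ∃[ e ] (e ∈ E G × φ₂ e ≡ y)
    φ-inc   : ∀ e v → e ∈ E G → v ∈ V G → ((e , v) ∈ ρ G ⇔ (φ₂ e , φ₁ v) ∈ ρ H)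

record VSP : Set₁ where
  field
    Π      : Graph → List ℕ → Set
    Π-sub  : ∀ G X → Π G X → ∀ v → v ∈ X → v ∈ V G
    Π-iso  : ∀ G H X Y → (φ : Iso G H) → Π G X → Y ≈ˢ mapℕ (Iso.φ₁ φ) X → Π H Y

open VSP public

-- Addressed trees.  Nodes are addresses: root = [], the i-th child
-- (0-based) of node u is  u ++ [ i ].

data Tree : Set where
  node : List Tree → Tree

mutual
  subtree : Tree → List ℕ → Maybe Tree
  subtree t [] = just t
  subtree (node ts) (i ∷ p) = subtreeL ts i p

  subtreeL : List Tree → ℕ → List ℕ → Maybe Tree
  subtreeL [] i p = nothing
  subtreeL (t ∷ ts) zero p = subtree t p
  subtreeL (t ∷ ts) (suc i) p = subtreeL ts i p

IsNode : Tree → List ℕ → Set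
IsNode T u = ∃[ t ] (subtree T u ≡ just t)

arityOf : Maybe Tree → ℕ
arityOf (just (node ts)) = length ts
arityOf nothing = 0

arity : Tree → List ℕ → ℕ
arity T u = arityOf (subtree T u)

ch : List ℕ → ℕ → List ℕ
ch u i = u ++ [ i ]

_≼_ : List ℕ → List ℕ → Set
p ≼ u = ∃[ s ] (p ++ s ≡ u)

OnPath : List ℕ → List ℕ → List ℕ → Set
OnPath p u w = ((p ≼ u) ⊎ (p ≼ w)) × (∀ q → q ≼ u → q ≼ w → q ≼ p)

record TreeDec (G : Graph) : Set where
  field
    T  : Tree
    B  : List ℕ → List ℕ
    ξ  : ℕ → List ℕ
    B-unique : ∀ u → IsNode T u → Unique (B u)
    B-sub    : ∀ u v → IsNode T u → v ∈ B u → v ∈ V G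
    ξ-node   : ∀ e → e ∈ E G → IsNode T (ξ e)
    ξ-inj    : ∀ e f → e ∈ E G → f ∈ E G → ξ e ≡ ξ f → e ≡ f
    vertex-cover : ∀ v → v ∈ V G → ∃[ u ] (IsNode T u × v ∈ B u)
    edge-cover   : ∀ e v → e ∈ E G → (e , v) ∈ ρ G → v ∈ B (ξ e)
    connected    : ∀ v u w p → IsNode T u → IsNode T w → v ∈ B u → v ∈ B w →
                   OnPath p u w → v ∈ B p
    binary   : ∀ u → IsNode T u → arity T u ≤ 2
    root-empty : B [] ≡ []
    leaf-empty : ∀ u → IsNode T u → arity T u ≡ 0 → B u ≡ []
    join-bags  : ∀ u → IsNode T u → arity T u ≡ 2 →
                 (B u ≈ˢ B (ch u 0)) × (B u ≈ˢ B (ch u 1))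
    unary-kind : ∀ u → IsNode T u → arity T u ≡ 1 →
        (∃[ v ] (v ∉ B (ch u 0) × (∀ x → x ∈ B u ⇔ (x ≡ v ⊎ x ∈ B (ch u 0)))))
      ⊎ (∃[ v ] (v ∉ B u × (∀ x → x ∈ B (ch u 0) ⇔ (x ≡ v ⊎ x ∈ B u))))
      ⊎ ((B u ≈ˢ B (ch u 0)) × ∃[ e ] (e ∈ E G × ξ e ≡ u))
    ξ-kind : ∀ e → e ∈ E G → (arity T (ξ e) ≡ 1) × (B (ξ e) ≈ˢ B (ch (ξ e) 0))

open TreeDec public

module _ {G : Graph} (𝒯 : TreeDec G) where

  LeafAt : List ℕ → Set
  LeafAt u = IsNode (T 𝒯) u × arity (T 𝒯) u ≡ 0

  IntroVAt : List ℕ → ℕ → Set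
  IntroVAt u v = IsNode (T 𝒯) u × arity (T 𝒯) u ≡ 1 × v ∉ B 𝒯 (ch u 0)
               × (∀ x → x ∈ B 𝒯 u ⇔ (x ≡ v ⊎ x ∈ B 𝒯 (ch u 0)))

  ForgetAt : List ℕ → ℕ → Set
  ForgetAt u v = IsNode (T 𝒯) u × arity (T 𝒯) u ≡ 1 × v ∉ B 𝒯 u
               × (∀ x → x ∈ B 𝒯 (ch u 0) ⇔ (x ≡ v ⊎ x ∈ B 𝒯 u))

  IntroEAt : List ℕ → ℕ → ℕ → Set
  IntroEAt u v v' = ∃[ e ] (e ∈ E G × ξ 𝒯 e ≡ u × Endpts G e v v')

  JoinAt : List ℕ → Set
  JoinAt u = IsNode (T 𝒯) u × arity (T 𝒯) u ≡ 2

  IsNu : ℕ → List ℕ → Set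
  IsNu v u = ∃[ p ] (u ≡ ch p 0 × ForgetAt p v)

  IsChar : List ℕ → (List ℕ → Bool) → Set
  IsChar X τ = ∀ u → IsNode (T 𝒯) u → (τ u ≡ true ⇔ (∃[ v ] (v ∈ X × IsNu v u)))

  Width : ℕ → Set
  Width k = (∀ u → IsNode (T 𝒯) u → length (B 𝒯 u) ≤ suc k)
          × ∃[ u ] (IsNode (T 𝒯) u × length (B 𝒯 u) ≡ suc k)

Str : Set
Str = List Bool

record DPCore : Set where
  field
    Leaf         : List Str
    Leaf-nonempty : Leaf ≢ []
    IntroVertex  : ℕ → Str → List Str
    IntroEdge    : ℕ → ℕ → Str → List Str
    ForgetVertex : ℕ → Str → List Str
    Join         : Str → Str → List Str
    Final        : Str → Bool

open DPCore public

module _ (D : DPCore) {G : Graph} (𝒯 : TreeDec G) where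

  data InΓ : List ℕ → Str → Set where
    γ-leaf   : ∀ {u w} → LeafAt 𝒯 u → w ∈ Leaf D → InΓ u w
    γ-introV : ∀ {u v w w'} → IntroVAt 𝒯 u v → InΓ (ch u 0) w' →
               w ∈ IntroVertex D v w' → InΓ u w
    γ-forget : ∀ {u v w w'} → ForgetAt 𝒯 u v → InΓ (ch u 0) w' →
               w ∈ ForgetVertex D v w' → InΓ u w
    γ-introE : ∀ {u v v' w w'} → IntroEAt 𝒯 u v v' → InΓ (ch u 0) w' →
               w ∈ IntroEdge D v v' w' → InΓ u w
    γ-join   : ∀ {u w w' w''} → JoinAt 𝒯 u → InΓ (ch u 0) w' →
               InΓ (ch u 1) w'' → w ∈ Join D w' w'' → InΓ u w

  Accepts : Set
  Accepts = ∃[ w ] (InΓ [] w × Final D w ≡ true)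

  LocalOK : (List ℕ → Str) → List ℕ → Set
  LocalOK W u =
      (LeafAt 𝒯 u × W u ∈ Leaf D)
    ⊎ (∃[ v ] (IntroVAt 𝒯 u v × W u ∈ IntroVertex D v (W (ch u 0))))
    ⊎ (∃[ v ] (ForgetAt 𝒯 u v × W u ∈ ForgetVertex D v (W (ch u 0))))
    ⊎ (∃[ v ] ∃[ v' ] (IntroEAt 𝒯 u v v' × W u ∈ IntroEdge D v v' (W (ch u 0))))
    ⊎ (JoinAt 𝒯 u × W u ∈ Join D (W (ch u 0)) (W (ch u 1)))

  WitnessTree : (List ℕ → Str) → Set
  WitnessTree W = (Final D (W []) ≡ true) × (∀ u → IsNode (T 𝒯) u → LocalOK W u)

  IsXset : (ℕ → Str → Bool) → (List ℕ → Str) → List ℕ → Set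
  IsXset μ W X = ∀ v → v ∈ X ⇔ (v ∈ V G × (∃[ u ] (IsNu 𝒯 v u × μ v (W u) ≡ true)))

Sol≠∅ : VSP → Graph → Set
Sol≠∅ P G = ∃[ X ] (Π P G X)

Solves : VSP → DPCore → Set
Solves P D = ∀ G (𝒯 : TreeDec G) → Accepts D 𝒯 ⇔ Sol≠∅ P G

TableComplexity : DPCore → (ℕ → ℕ → ℕ) → Set
TableComplexity D α = ∀ (G : Graph) (𝒯 : TreeDec G) k n → length (V G) ≡ n →
  (∀ u → IsNode (T 𝒯) u → length (B 𝒯 u) ≤ suc k) →
  ∀ u → IsNode (T 𝒯) u → ∃[ L ] (length L ≤ α k n × (∀ w → InΓ D 𝒯 u w → w ∈ L))

SolutionPreserving : VSP → DPCore → Set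
SolutionPreserving P D = ∃[ μ ] (∀ G (𝒯 : TreeDec G) → Accepts D 𝒯 →
    (∀ W → WitnessTree D 𝒯 W → ∀ X → IsXset D 𝒯 μ W X → Π P G X)
  × (∀ X → Π P G X → ∃[ W ] (WitnessTree D 𝒯 W × IsXset D 𝒯 μ W X)))

-- T-shaped tree automata over Σ = {0,1} = Bool.
-- Cell Q_u = Fin (q u); Δ_u ⊆ Q_{u·0} × … × Q_{u·(s-1)} × Σ × Q_u.

record Automaton (T : Tree) : Set₁ where
  field
    q : List ℕ → ℕ
    F : Fin (q []) → Set
    Δ : (u : List ℕ) → ((i : Fin (arity T u)) → Fin (q (ch u (toℕ i)))) →
        Bool → Fin (q u) → Set

open Automaton public

module _ {T : Tree} (𝒜 : Automaton T) where

  IsTrace : (List ℕ → Bool) → ((u : List ℕ) → Fin (q 𝒜 u)) → Set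
  IsTrace τ r = ∀ u → IsNode T u → Δ 𝒜 u (λ i → r (ch u (toℕ i))) (τ u) (r u)

  InLanguage : (List ℕ → Bool) → Set
  InLanguage τ = ∃[ r ] (IsTrace τ r × F 𝒜 (r []))

  WidthAtMost : ℕ → Set
  WidthAtMost a = ∀ u → IsNode T u → q 𝒜 u ≤ a

-- τ ∈ Φ_Π(G,𝒯) = { χ[G,𝒯,X] : X ∈ Sol_Π(G) }   (terms compared on N(T))
InΦ : VSP → (G : Graph) → TreeDec G → (List ℕ → Bool) → Set
InΦ P G 𝒯 τ = ∃[ X ] (Π P G X × IsChar 𝒯 X τ)

{-# OPTIONS --safe #-}
-- The states of the automaton at a node u are the positions of a listing of
-- the DP table Γ(u), which has at most α(k,n) entries. A transition at u is
-- allowed when the strings it names obey the rule of the DP-core at u, and it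
-- reads the letter 1 exactly when the string at u makes μ select a vertex v
-- with ν(v) = u. Accepting runs are therefore the same as witness trees W
-- (every string of a witness tree lies in its table), and a run reads
-- χ[G,𝒯,𝐗(W)] because ν(v) is unique. By solution preservation the sets
-- 𝐗(W) are exactly the solutions; acceptance, needed to invoke it, comes from
-- the witness tree itself in one direction and from Solves in the other.
module Submission where

open import Defs
open import Data.Nat using (ℕ; zero; suc; _<_; _≤_; _≟_; z<s; s<s)
open import Data.Bool using (Bool; true)
import Data.Bool as Bool
open import Data.Fin using (Fin; toℕ; fromℕ<)
import Data.Fin as Fin
open import Data.Fin.Properties using (toℕ-fromℕ<; toℕ<n)
open import Data.List using (List; []; _∷_; _++_; [_]; length; lookup; map; filter)
open import Data.List.Properties
  using (++-conicalˡ; ++-identityʳ; ++-identityʳ-unique; ++-assoc;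
         ∷-injectiveˡ; ∷-injectiveʳ; ∷ʳ-injective)
open import Data.List.Membership.Propositional using (_∈_; lose)
open import Data.List.Membership.Propositional.Properties
  using (∈-filter⁺; ∈-filter⁻; ∈-map⁺; ∈-++⁺ˡ; ∈-++⁺ʳ)
open import Data.List.Membership.DecPropositional _≟_ using (_∈?_)
open import Data.List.Relation.Binary.Subset.DecPropositional _≟_ using (_⊆?_)
open import Data.List.Relation.Unary.Any using (here; there; satisfied; index; any?; toSum; fromSum)
open import Data.List.Relation.Unary.Any.Properties using (lookup-index)
open import Data.Maybe using (just; nothing)
open import Data.Product using (Σ; ∃; ∃-syntax; _×_; _,_; proj₁; proj₂)
open import Data.Sum using (_⊎_; inj₁; inj₂)
open import Data.Empty using (⊥-elim)
open import Function.Base using (_∘_)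
open import Function.Bundles using (_⇔_; mk⇔; Equivalence)
import Function.Properties.Equivalence as ⇔
open import Relation.Nullary using (Dec; yes; no; ¬_)
open import Relation.Nullary.Decidable using (map′; _×-dec_; ¬?)
open import Relation.Unary using (Decidable)
open import Relation.Binary.PropositionalEquality using (_≡_; refl; sym; trans; cong; subst; subst₂)

open Equivalence

mutual
  subtree-++ : (t : Tree) (u p : List ℕ) {t' : Tree} →
               subtree t u ≡ just t' → subtree t (u ++ p) ≡ subtree t' p
  subtree-++ t [] p refl = refl
  subtree-++ (node ts) (i ∷ u) p e = subtreeL-++ ts i u p e

  subtreeL-++ : (ts : List Tree) (i : ℕ) (u p : List ℕ) {t' : Tree} →
                subtreeL ts i u ≡ just t' → subtreeL ts i (u ++ p) ≡ subtree t' p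
  subtreeL-++ [] i u p ()
  subtreeL-++ (t ∷ ts) zero u p e = subtree-++ t u p e
  subtreeL-++ (t ∷ ts) (suc i) u p e = subtreeL-++ ts i u p e

subtreeL-< : (ts : List Tree) (i : ℕ) → i < length ts → ∃[ t ] (subtreeL ts i [] ≡ just t)
subtreeL-< (t ∷ ts) zero _ = t , refl
subtreeL-< (t ∷ ts) (suc i) (s<s i<n) = subtreeL-< ts i i<n

<-subst : {a m i : ℕ} → a ≡ m → i < m → i < a
<-subst refl i<m = i<m

ch-isNode : (T : Tree) (u : List ℕ) {i : ℕ} → IsNode T u → i < arity T u → IsNode T (ch u i)
ch-isNode T u {i} (node ts , e) i<a =
  let (t , eᵢ) = subtreeL-< ts i (subst (i <_) (cong arityOf e) i<a)
  in t , trans (subtree-++ T u [ i ] e) eᵢ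

module _ (T : Tree) (P : List ℕ → Set)
         (step : ∀ u → IsNode T u → (∀ i → i < arity T u → P (ch u i)) → P u) where

  private
    mutual
      at : (t : Tree) (u : List ℕ) → subtree T u ≡ just t → P u
      at (node ts) u e = step u (node ts , e) λ i i<a →
        atChild ts u i (subst (i <_) (cong arityOf e) i<a) (subtree-++ T u [ i ] e)

      atChild : (ts : List Tree) (u : List ℕ) {j : ℕ} (i : ℕ) → i < length ts →
                subtree T (ch u j) ≡ subtreeL ts i [] → P (ch u j)
      atChild (t ∷ ts) u {j} zero _ e = at t (ch u j) e
      atChild (t ∷ ts) u (suc i) (s<s i<n) e = atChild ts u i i<n e

  node-induction : ∀ u → IsNode T u → P u
  node-induction u (t , e) = at t u e

isNode? : (T : Tree) (u : List ℕ) → Dec (IsNode T u)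
isNode? T u with subtree T u
... | just t = yes (t , refl)
... | nothing = no λ { (_ , ()) }

incHead : List ℕ → List ℕ
incHead [] = []
incHead (i ∷ u) = suc i ∷ u

mutual
  nodes : Tree → List (List ℕ)
  nodes (node ts) = [] ∷ childNodes ts

  childNodes : List Tree → List (List ℕ)
  childNodes [] = []
  childNodes (t ∷ ts) = map (0 ∷_) (nodes t) ++ map incHead (childNodes ts)

mutual
  ∈-nodes : (t : Tree) {u : List ℕ} → IsNode t u → u ∈ nodes t
  ∈-nodes (node ts) {[]} _ = here refl
  ∈-nodes (node ts) {i ∷ u} nd = there (∈-childNodes ts i nd)

  ∈-childNodes : (ts : List Tree) (i : ℕ) {u : List ℕ} →
                 ∃[ t ] (subtreeL ts i u ≡ just t) → (i ∷ u) ∈ childNodes ts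
  ∈-childNodes [] i (_ , ())
  ∈-childNodes (t ∷ ts) zero nd = ∈-++⁺ˡ (∈-map⁺ (0 ∷_) (∈-nodes t nd))
  ∈-childNodes (t ∷ ts) (suc i) nd =
    ∈-++⁺ʳ (map (0 ∷_) (nodes t)) (∈-map⁺ incHead (∈-childNodes ts i nd))

∃-node? : (T : Tree) {P : List ℕ → Set} →
          (∀ {u} → P u → IsNode T u) → Decidable P → Dec (∃ P)
∃-node? T P⇒node P? =
  map′ satisfied (λ (u , pu) → lose (∈-nodes T (P⇒node pu)) pu) (any? P? (nodes T))

_≼?_ : (a b : List ℕ) → Dec (a ≼ b)
[] ≼? b = yes (b , refl)
(x ∷ a) ≼? [] = no λ { (_ , ()) }
(x ∷ a) ≼? (y ∷ b) with x ≟ y | a ≼? b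
... | yes refl | yes (s , e) = yes (s , cong (x ∷_) e)
... | yes refl | no a⋠b = no λ { (s , e) → a⋠b (s , ∷-injectiveʳ e) }
... | no x≢y | _ = no λ { (s , e) → x≢y (∷-injectiveˡ e) }

≼-antisym : {a b : List ℕ} → a ≼ b → b ≼ a → a ≡ b
≼-antisym {a} (s , refl) (t , a++s++t≡a) = sym (trans (cong (a ++_) s≡[]) (++-identityʳ a))
  where
  s≡[] : s ≡ []
  s≡[] = ++-conicalˡ s t (++-identityʳ-unique a (trans (sym a++s++t≡a) (++-assoc a s t)))

≼-∷ʳ⁻ : (q p : List ℕ) (i : ℕ) → q ≼ ch p i → q ≼ p ⊎ q ≡ ch p i
≼-∷ʳ⁻ [] p i _ = inj₁ (p , refl)
≼-∷ʳ⁻ (x ∷ q) [] i (s , e) with ++-conicalˡ q s (∷-injectiveʳ e) | ∷-injectiveˡ e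
... | refl | refl = inj₂ refl
≼-∷ʳ⁻ (x ∷ q) (y ∷ p) i (s , e) with ∷-injectiveˡ e | ≼-∷ʳ⁻ q p i (s , ∷-injectiveʳ e)
... | refl | inj₁ (s' , e') = inj₁ (s' , cong (x ∷_) e')
... | refl | inj₂ e' = inj₂ (cong (x ∷_) e')

parent-onPath : {p w : List ℕ} (i : ℕ) → ¬ (ch p i ≼ w) → OnPath p (ch p i) w
parent-onPath {p} i pi⋠w = inj₁ ([ i ] , refl) , common
  where
  common : ∀ q → q ≼ ch p i → q ≼ _ → q ≼ p
  common q q≼pi q≼w with ≼-∷ʳ⁻ q p i q≼pi
  ... | inj₁ q≼p = q≼p
  ... | inj₂ refl = ⊥-elim (pi⋠w q≼w)

≈-∷? : (A : List ℕ) (v : ℕ) (Bs : List ℕ) → Dec (∀ x → x ∈ A ⇔ (x ≡ v ⊎ x ∈ Bs))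
≈-∷? A v Bs = map′
  (λ (A⊆ , ⊆A) x → mk⇔ (λ x∈A → toSum (A⊆ x∈A)) (λ x∈v∷Bs → ⊆A (fromSum x∈v∷Bs)))
  (λ A≈ → (λ {x} x∈A → fromSum (to (A≈ x) x∈A))
         , (λ {x} x∈v∷Bs → from (A≈ x) (toSum x∈v∷Bs)))
  (A ⊆? (v ∷ Bs) ×-dec (v ∷ Bs) ⊆? A)

module _ {G : Graph} (𝒯 : TreeDec G) where

  forget? : ∀ p v → Dec (ForgetAt 𝒯 p v)
  forget? p v = isNode? (T 𝒯) p ×-dec arity (T 𝒯) p ≟ 1 ×-dec ¬? (v ∈? B 𝒯 p)
                ×-dec ≈-∷? (B 𝒯 (ch p 0)) v (B 𝒯 p)

  -- Otherwise p lies on the tree path between the two children, whose bags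
  -- contain v, so connectivity would put v into B p.
  ¬¬forget-child-≼ : ∀ {p p' v} → ForgetAt 𝒯 p v → ForgetAt 𝒯 p' v →
                     ¬ ¬ (ch p 0 ≼ ch p' 0)
  ¬¬forget-child-≼ {p} {p'} {v} (nd , ar , v∉p , bag) (nd' , ar' , _ , bag') p0⋠p'0 =
    v∉p (connected 𝒯 v (ch p 0) (ch p' 0) p
          (ch-isNode (T 𝒯) p nd (<-subst ar z<s)) (ch-isNode (T 𝒯) p' nd' (<-subst ar' z<s))
          (from (bag v) (inj₁ refl)) (from (bag' v) (inj₁ refl))
          (parent-onPath 0 p0⋠p'0))

  forget-unique : ∀ {p p' v} → ForgetAt 𝒯 p v → ForgetAt 𝒯 p' v → p ≡ p'
  forget-unique {p} {p'} f f' with ch p 0 ≼? ch p' 0 | ch p' 0 ≼? ch p 0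
  ... | no p0⋠p'0 | _ = ⊥-elim (¬¬forget-child-≼ f f' p0⋠p'0)
  ... | _ | no p'0⋠p0 = ⊥-elim (¬¬forget-child-≼ f' f p'0⋠p0)
  ... | yes p0≼p'0 | yes p'0≼p0 = proj₁ (∷ʳ-injective p p' (≼-antisym p0≼p'0 p'0≼p0))

  ν-unique : ∀ {v u u'} → IsNu 𝒯 v u → IsNu 𝒯 v u' → u ≡ u'
  ν-unique (p , refl , f) (p' , refl , f') = cong (λ x → ch x 0) (forget-unique f f')

pattern leaf-ok l w∈ = inj₁ (l , w∈)
pattern introV-ok v iv w∈ = inj₂ (inj₁ (v , iv , w∈))
pattern forget-ok v fv w∈ = inj₂ (inj₂ (inj₁ (v , fv , w∈)))
pattern introE-ok v v' ie w∈ = inj₂ (inj₂ (inj₂ (inj₁ (v , v' , ie , w∈))))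
pattern join-ok j w∈ = inj₂ (inj₂ (inj₂ (inj₂ (j , w∈))))

module _ (D : DPCore) {G : Graph} (𝒯 : TreeDec G) where

  introE-unary : ∀ {u v v'} → IntroEAt 𝒯 u v v' → arity (T 𝒯) u ≡ 1
  introE-unary (e , e∈E , refl , _) = proj₁ (ξ-kind 𝒯 e e∈E)

  LocalOK-cong : ∀ {W W' u} → W u ≡ W' u →
                 (∀ i → i < arity (T 𝒯) u → W (ch u i) ≡ W' (ch u i)) →
                 LocalOK D 𝒯 W u → LocalOK D 𝒯 W' u
  LocalOK-cong eq eqᶜ (leaf-ok l w∈) = leaf-ok l (subst (_∈ Leaf D) eq w∈)
  LocalOK-cong eq eqᶜ (introV-ok v iv@(_ , ar , _) w∈) =
    introV-ok v iv (subst₂ (λ a b → a ∈ IntroVertex D v b) eq (eqᶜ 0 (<-subst ar z<s)) w∈)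
  LocalOK-cong eq eqᶜ (forget-ok v fv@(_ , ar , _) w∈) =
    forget-ok v fv (subst₂ (λ a b → a ∈ ForgetVertex D v b) eq (eqᶜ 0 (<-subst ar z<s)) w∈)
  LocalOK-cong eq eqᶜ (introE-ok v v' ie w∈) =
    introE-ok v v' ie (subst₂ (λ a b → a ∈ IntroEdge D v v' b) eq
                                (eqᶜ 0 (<-subst (introE-unary ie) z<s)) w∈)
  LocalOK-cong {W} {W'} {u} eq eqᶜ (join-ok j@(_ , ar) w∈) =
    join-ok j (subst₂ (λ a b → a ∈ Join D b (W' (ch u 1))) eq (eqᶜ 0 (<-subst ar z<s))
                (subst (λ b → W u ∈ Join D (W (ch u 0)) b) (eqᶜ 1 (<-subst ar (s<s z<s))) w∈))

  locallyOK⇒∈Γ : ∀ {W} → (∀ u → IsNode (T 𝒯) u → LocalOK D 𝒯 W u) →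
                 ∀ u → IsNode (T 𝒯) u → InΓ D 𝒯 u (W u)
  locallyOK⇒∈Γ {W} ok = node-induction (T 𝒯) (λ u → InΓ D 𝒯 u (W u)) step
    where
    step : ∀ u → IsNode (T 𝒯) u →
           (∀ i → i < arity (T 𝒯) u → InΓ D 𝒯 (ch u i) (W (ch u i))) → InΓ D 𝒯 u (W u)
    step u nd below with ok u nd
    ... | leaf-ok l w∈ = γ-leaf l w∈
    ... | introV-ok v iv@(_ , ar , _) w∈ = γ-introV iv (below 0 (<-subst ar z<s)) w∈
    ... | forget-ok v fv@(_ , ar , _) w∈ = γ-forget fv (below 0 (<-subst ar z<s)) w∈
    ... | introE-ok v v' ie w∈ = γ-introE ie (below 0 (<-subst (introE-unary ie) z<s)) w∈
    ... | join-ok j@(_ , ar) w∈ =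
      γ-join j (below 0 (<-subst ar z<s)) (below 1 (<-subst ar (s<s z<s))) w∈

  witness⇒accepts : ∀ {W} → WitnessTree D 𝒯 W → Accepts D 𝒯
  witness⇒accepts {W} (final , ok) = W [] , locallyOK⇒∈Γ ok [] (T 𝒯 , refl) , final

  module _ (μ : ℕ → Str → Bool) (W : List ℕ → Str) where

    forgotten-selected? : Decidable (λ v → ∃[ p ] (ForgetAt 𝒯 p v × μ v (W (ch p 0)) ≡ true))
    forgotten-selected? v =
      ∃-node? (T 𝒯) (proj₁ ∘ proj₁)
              (λ p → forget? 𝒯 p v ×-dec μ v (W (ch p 0)) Bool.≟ true)

    𝐗 : List ℕ
    𝐗 = filter forgotten-selected? (V G)

    𝐗-isXset : IsXset D 𝒯 μ W 𝐗
    𝐗-isXset v = mk⇔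
      (λ v∈𝐗 → let (v∈V , p , f , sel) = ∈-filter⁻ forgotten-selected? v∈𝐗
               in v∈V , ch p 0 , (p , refl , f) , sel)
      (λ { (v∈V , _ , (p , refl , f) , sel) → ∈-filter⁺ forgotten-selected? v∈V (p , f , sel) })

  Selects : (μ : ℕ → Str → Bool) → List ℕ → Str → Set
  Selects μ u s = ∃[ v ] (v ∈ V G × IsNu 𝒯 v u × μ v s ≡ true)

  isXset⇒selects : ∀ μ W {X} → IsXset D 𝒯 μ W X →
                   ∀ u → (∃[ v ] (v ∈ X × IsNu 𝒯 v u)) ⇔ Selects μ u (W u)
  isXset⇒selects μ W X≈ u = mk⇔
    (λ (v , v∈X , νv) → let (v∈V , u' , νv' , sel) = to (X≈ v) v∈X in
      v , v∈V , νv , subst (λ x → μ v (W x) ≡ true) (ν-unique 𝒯 νv' νv) sel)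
    (λ (v , v∈V , νv , sel) → v , from (X≈ v) (v∈V , u , νv , sel) , νv)

module TableAutomaton (D : DPCore) {G : Graph} (𝒯 : TreeDec G)
                      (μ : ℕ → Str → Bool) (table : List ℕ → List Str) where

  state : (u : List ℕ) → Fin (length (table u)) → Str
  state u = lookup (table u)

  -- LocalOK W u inspects W only at u and its children, so Δ is a local condition.
  automaton : Automaton (T 𝒯)
  automaton = record
    { q = λ u → length (table u)
    ; F = λ s → Final D (state [] s) ≡ true
    ; Δ = λ u c b s → ∃[ W ] (W u ≡ state u s
                              × (∀ i → W (ch u (toℕ i)) ≡ state (ch u (toℕ i)) (c i))
                              × LocalOK D 𝒯 W u
                              × (b ≡ true ⇔ Selects D 𝒯 μ u (state u s)))
    }

  run-labels : ((u : List ℕ) → Fin (length (table u))) → List ℕ → Str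
  run-labels r u = state u (r u)

  accepting⇒witness : ∀ {τ r} → IsTrace automaton τ r → F automaton (r []) →
                      WitnessTree D 𝒯 (run-labels r)
  accepting⇒witness {τ} {r} tr final = final , ok
    where
    ok : ∀ u → IsNode (T 𝒯) u → LocalOK D 𝒯 (run-labels r) u
    ok u nd = let (W , at-u , at-children , okW , _) = tr u nd in
      LocalOK-cong D 𝒯 {W} {run-labels r} at-u
        (λ i i<a → subst (λ j → W (ch u j) ≡ run-labels r (ch u j))
                          (toℕ-fromℕ< i<a) (at-children (fromℕ< i<a)))
        okW

  trace-selects : ∀ {τ r} → IsTrace automaton τ r →
                  ∀ u → IsNode (T 𝒯) u → τ u ≡ true ⇔ Selects D 𝒯 μ u (run-labels r u)
  trace-selects tr u nd = let (_ , _ , _ , _ , letter) = tr u nd in letter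

  witness⇒accepting : ∀ {τ r W} → WitnessTree D 𝒯 W →
                      (∀ u → IsNode (T 𝒯) u → run-labels r u ≡ W u) →
                      (∀ u → IsNode (T 𝒯) u → τ u ≡ true ⇔ Selects D 𝒯 μ u (W u)) →
                      IsTrace automaton τ r × F automaton (r [])
  witness⇒accepting {τ} {r} {W} (final , ok) labels letters = trace , accepting
    where
    trace : IsTrace automaton τ r
    trace u nd = W , sym (labels u nd)
               , (λ i → sym (labels (ch u (toℕ i)) (ch-isNode (T 𝒯) u nd (toℕ<n i))))
               , ok u nd
               , subst (λ s → τ u ≡ true ⇔ Selects D 𝒯 μ u s) (sym (labels u nd)) (letters u nd)
    accepting : Final D (run-labels r []) ≡ true
    accepting = subst (λ s → Final D s ≡ true) (sym (labels [] (T 𝒯 , refl))) final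

module DPCoreAutomaton (P : VSP) (D : DPCore) (α : ℕ → ℕ → ℕ)
         (preserving : SolutionPreserving P D) (complexity : TableComplexity D α)
         (solves : Solves P D) (G : Graph) (n k : ℕ) (|V|≡n : length (V G) ≡ n)
         (𝒯 : TreeDec G) (width : Width 𝒯 k) where

  μ : ℕ → Str → Bool
  μ = proj₁ preserving

  Γ-listing : ∀ u → IsNode (T 𝒯) u →
              ∃[ L ] (length L ≤ α k n × (∀ w → InΓ D 𝒯 u w → w ∈ L))
  Γ-listing = complexity G 𝒯 k n |V|≡n (proj₁ width)

  -- A trace assigns a state to every address, not only to nodes of T, so the
  -- cells off the tree must be inhabited.
  cells : ∀ u → Dec (IsNode (T 𝒯) u) → List Str
  cells u (yes nd) = proj₁ (Γ-listing u nd)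
  cells u (no _) = [ [] ]

  table : List ℕ → List Str
  table u = cells u (isNode? (T 𝒯) u)

  open TableAutomaton D 𝒯 μ table public

  sound : Accepts D 𝒯 → ∀ W → WitnessTree D 𝒯 W → ∀ X → IsXset D 𝒯 μ W X → Π P G X
  sound accepts = proj₁ (proj₂ preserving G 𝒯 accepts)

  complete : Accepts D 𝒯 → ∀ X → Π P G X →
             ∃[ W ] (WitnessTree D 𝒯 W × IsXset D 𝒯 μ W X)
  complete accepts = proj₂ (proj₂ preserving G 𝒯 accepts)

  table-bounded : ∀ u → IsNode (T 𝒯) u → length (table u) ≤ α k n
  table-bounded u nd with isNode? (T 𝒯) u
  ... | yes nd' = proj₁ (proj₂ (Γ-listing u nd'))
  ... | no ¬nd = ⊥-elim (¬nd nd)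

  table-covers : ∀ {u w} → IsNode (T 𝒯) u → InΓ D 𝒯 u w → w ∈ table u
  table-covers {u} nd w∈Γ with isNode? (T 𝒯) u
  ... | yes nd' = proj₂ (proj₂ (Γ-listing u nd')) _ w∈Γ
  ... | no ¬nd = ⊥-elim (¬nd nd)

  module _ (W : List ℕ → Str) (W∈ : ∀ u → IsNode (T 𝒯) u → W u ∈ table u) where

    position : (u : List ℕ) → Fin (length (table u))
    position u with isNode? (T 𝒯) u | W∈ u
    ... | yes nd | W∈u = index (W∈u nd)
    ... | no _ | _ = Fin.zero

    state-position : ∀ u → IsNode (T 𝒯) u → run-labels position u ≡ W u
    state-position u nd with isNode? (T 𝒯) u | W∈ u
    ... | yes nd' | W∈u = sym (lookup-index (W∈u nd'))
    ... | no ¬nd | _ = ⊥-elim (¬nd nd)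

  witness⇒language : ∀ {τ W} → WitnessTree D 𝒯 W →
                     (∀ u → IsNode (T 𝒯) u → τ u ≡ true ⇔ Selects D 𝒯 μ u (W u)) →
                     InLanguage automaton τ
  witness⇒language {τ} {W} witness letters =
    position W W∈ , witness⇒accepting witness (state-position W W∈) letters
    where
    W∈ : ∀ u → IsNode (T 𝒯) u → W u ∈ table u
    W∈ u nd = table-covers nd (locallyOK⇒∈Γ D 𝒯 (proj₂ witness) u nd)

  language⊆Φ : ∀ τ → InLanguage automaton τ → InΦ P G 𝒯 τ
  language⊆Φ τ (r , trace , final) = 𝐗 D 𝒯 μ W , solution , characteristic
    where
    W : List ℕ → Str
    W = run-labels r
    witness : WitnessTree D 𝒯 W
    witness = accepting⇒witness trace final
    solution : Π P G (𝐗 D 𝒯 μ W)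
    solution = sound (witness⇒accepts D 𝒯 witness) W witness _ (𝐗-isXset D 𝒯 μ W)
    characteristic : IsChar 𝒯 (𝐗 D 𝒯 μ W) τ
    characteristic u nd =
      ⇔.trans (trace-selects trace u nd)
              (⇔.sym (isXset⇒selects D 𝒯 μ W (𝐗-isXset D 𝒯 μ W) u))

  Φ⊆language : ∀ τ → InΦ P G 𝒯 τ → InLanguage automaton τ
  Φ⊆language τ (X , solution , characteristic) =
    let (W , witness , X≈) = complete (from (solves G 𝒯) (X , solution)) X solution
    in witness⇒language witness λ u nd →
         ⇔.trans (characteristic u nd) (isXset⇒selects D 𝒯 μ W X≈ u)

theorem5p5 : (P : VSP) (D : DPCore) (α : ℕ → ℕ → ℕ) →
    SolutionPreserving P D → TableComplexity D α → Solves P D →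
    (G : Graph) (n k : ℕ) → length (V G) ≡ n →
    (𝒯 : TreeDec G) → Width 𝒯 k →
    Σ (Automaton (T 𝒯)) λ 𝒜 →
      WidthAtMost 𝒜 (α k n) × (∀ τ → InLanguage 𝒜 τ ⇔ InΦ P G 𝒯 τ)
theorem5p5 P D α preserving complexity solves G n k |V|≡n 𝒯 width =
  automaton , table-bounded , λ τ → mk⇔ (language⊆Φ τ) (Φ⊆language τ)
  where open DPCoreAutomaton P D α preserving complexity solves G n k |V|≡n 𝒯 width
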